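{- Let $\mathcal A$ be an $n$-indexed hyperspace and $\mathcal B$ a $d$-indexed hyperspace such that $\mathcal B$ is parbeddable into $\mathcal A$. If $\mathcal A$ has an acceptable coloring, then so does $\mathcal B$.
   Context: An $n$-indexed hyperspace is $(A;E_0,\dots,E_{n-1})$ with each $E_i$ an equivalence relation on $A$; $[a]_i$ is the $E_i$-class of $a$. A coloring of an $n$-indexed hyperspace is $\chi:A\to n$; it is acceptable if for all $a\in A$, $i<n$, $\{x\in[a]_i:\chi(x)=i\}$ is finite. For $\beta:n\to d$, a $\beta$-parbedding of the $d$-indexed $\mathcal B$ into the $n$-indexed $\mathcal A$ is a one-to-one $f:B\to A$ such that for all $x,y\in B$ and $i<n$: $[x]_{\beta(i)}=[y]_{\beta(i)}\implies[f(x)]_i=[f(y)]_i$; $\mathcal B$ is parbeddable into $\mathcal A$ if some $\beta$-parbedding exists. -}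

module Defs where

open import Level using (Level; _⊔_; suc)
open import Data.Nat using (ℕ)
open import Data.Fin using (Fin)
open import Data.Product using (Σ; ∃; _×_)
open import Relation.Binary.Core using (Rel)
open import Relation.Binary.Structures using (IsEquivalence)
open import Relation.Binary.PropositionalEquality using (_≡_)
open import Function.Definitions using (Injective)

record Hyperspace (a ℓ : Level) (n : ℕ) : Set (Level.suc (a ⊔ ℓ)) where
  field
    Carrier : Set a
    E       : Fin n → Rel Carrier ℓ
    E-equiv : (i : Fin n) → IsEquivalence (E i)

open Hyperspace public

-- A subset {x | P x} of X is finite if it injects into some Fin k:
-- there is a map g sending each member x (with a witness of P x) to Fin k
-- such that members with the same image are equal (as elements of X).
FiniteSubset : {a p : Level} {X : Set a} → (X → Set p) → Set (a ⊔ p)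
FiniteSubset {X = X} P =
  Σ ℕ λ k → Σ ((x : X) → P x → Fin k) λ g →
    ∀ x y (px : P x) (py : P y) → g x px ≡ g y py → x ≡ y

Coloring : {a ℓ : Level} {n : ℕ} → Hyperspace a ℓ n → Set a
Coloring {n = n} 𝒜 = Carrier 𝒜 → Fin n

Acceptable : {a ℓ : Level} {n : ℕ} (𝒜 : Hyperspace a ℓ n) → Coloring 𝒜 → Set (a ⊔ ℓ)
Acceptable {n = n} 𝒜 χ =
  (x₀ : Carrier 𝒜) (i : Fin n) → FiniteSubset (λ x → E 𝒜 i x₀ x × χ x ≡ i)

HasAcceptableColoring : {a ℓ : Level} {n : ℕ} → Hyperspace a ℓ n → Set (a ⊔ ℓ)
HasAcceptableColoring 𝒜 = Σ (Coloring 𝒜) (Acceptable 𝒜)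

-- For β : n → d, a β-parbedding of the d-indexed ℬ into the n-indexed 𝒜:
-- a one-to-one f : B → A such that for all x, y ∈ B and i < n,
-- [x]_{β(i)} = [y]_{β(i)} implies [f x]_i = [f y]_i.
-- (Equality of classes [x]_j = [y]_j is the relation E_j x y.)
IsParbedding : {a b ℓ ℓ' : Level} {n d : ℕ}
  (ℬ : Hyperspace b ℓ' d) (𝒜 : Hyperspace a ℓ n) (β : Fin n → Fin d)
  (f : Carrier ℬ → Carrier 𝒜) → Set (a ⊔ b ⊔ ℓ ⊔ ℓ')
IsParbedding {n = n} ℬ 𝒜 β f =
  Injective _≡_ _≡_ f ×
  (∀ (x y : Carrier ℬ) (i : Fin n) → E ℬ (β i) x y → E 𝒜 i (f x) (f y))

Parbeddable : {a b ℓ ℓ' : Level} {n d : ℕ}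
  (ℬ : Hyperspace b ℓ' d) (𝒜 : Hyperspace a ℓ n) → Set (a ⊔ b ⊔ ℓ ⊔ ℓ')
Parbeddable {n = n} {d = d} ℬ 𝒜 =
  Σ (Fin n → Fin d) λ β → Σ (Carrier ℬ → Carrier 𝒜) λ f → IsParbedding ℬ 𝒜 β f

-- Pull the coloring back along the parbedding: colour x ∈ B by β (χ (f x)).
-- If x lies in the E_j-class of x₀ and has colour j, then with i = χ (f x) we
-- have β i = j, so f x lies in the E_i-class of f x₀ and has colour i there.
-- Hence f injects the j-part of [x₀]_j into the union over i < n of the finite
-- sets {y ∈ [f x₀]_i : χ y = i}, which is finite.
module Submission where

open import Level using (Level)
open import Data.Nat using (ℕ; zero; suc; _+_)
open import Data.Fin using (Fin; join; splitAt)
import Data.Fin as Fin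
open import Data.Fin.Properties using (splitAt-join)
open import Data.Product using (Σ; _×_; _,_)
open import Data.Sum using (_⊎_; inj₁; inj₂)
open import Data.Sum.Properties using (inj₁-injective; inj₂-injective)
open import Function using (_∘_; id)
open import Function.Definitions using (Injective)
open import Relation.Binary.PropositionalEquality using (_≡_; refl; sym; trans; cong; subst)
open import Defs

private
  variable
    a b p q : Level
    X : Set a
    Y : Set b

join-injective : ∀ k l → Injective _≡_ _≡_ (join k l)
join-injective k l {u} {v} eq =
  trans (sym (splitAt-join k l u)) (trans (cong (splitAt k) eq) (splitAt-join k l v))

FiniteSubset-preimage : {P : X → Set p} {Q : Y → Set q} (f : X → Y) →
  Injective _≡_ _≡_ f → (∀ x → P x → Q (f x)) →
  FiniteSubset Q → FiniteSubset P
FiniteSubset-preimage f f-inj P⇒Q (k , g , g-inj) =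
  k , (λ x px → g (f x) (P⇒Q x px)) ,
  λ x y px py eq → f-inj (g-inj (f x) (f y) (P⇒Q x px) (P⇒Q y py) eq)

FiniteSubset-⊆ : {P : X → Set p} {Q : X → Set q} →
  (∀ x → P x → Q x) → FiniteSubset Q → FiniteSubset P
FiniteSubset-⊆ = FiniteSubset-preimage id id

FiniteSubset-∪ : {P Q : X → Set p} →
  FiniteSubset P → FiniteSubset Q → FiniteSubset (λ x → P x ⊎ Q x)
FiniteSubset-∪ {X = X} {P = P} {Q = Q} (k , g , g-inj) (l , h , h-inj) =
  k + l , (λ x r → join k l (tag x r)) ,
  λ x y r s eq → tag-injective x y r s (join-injective k l eq)
  where
  tag : ∀ x → P x ⊎ Q x → Fin k ⊎ Fin l
  tag x (inj₁ px) = inj₁ (g x px)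
  tag x (inj₂ qx) = inj₂ (h x qx)

  tag-injective : ∀ x y r s → tag x r ≡ tag y s → x ≡ y
  tag-injective x y (inj₁ px) (inj₁ py) eq = g-inj x y px py (inj₁-injective eq)
  tag-injective x y (inj₂ qx) (inj₂ qy) eq = h-inj x y qx qy (inj₂-injective eq)
  tag-injective x y (inj₁ _)  (inj₂ _)  ()
  tag-injective x y (inj₂ _)  (inj₁ _)  ()

FiniteSubset-⋃ : {n : ℕ} {P : Fin n → X → Set p} →
  (∀ i → FiniteSubset (P i)) → FiniteSubset (λ x → Σ (Fin n) λ i → P i x)
FiniteSubset-⋃ {n = zero} _ = 0 , (λ { _ (() , _) }) , λ { _ _ (() , _) }
FiniteSubset-⋃ {n = suc n} {P = P} finite =
  FiniteSubset-⊆ split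
    (FiniteSubset-∪ (finite Fin.zero) (FiniteSubset-⋃ (finite ∘ Fin.suc)))
  where
  split : ∀ x → Σ (Fin (suc n)) (λ i → P i x) →
          P Fin.zero x ⊎ Σ (Fin n) (λ i → P (Fin.suc i) x)
  split x (Fin.zero  , px) = inj₁ px
  split x (Fin.suc i , px) = inj₂ (i , px)

lemma3p6 : {a b ℓ ℓ' : Level} {n d : ℕ}
    (𝒜 : Hyperspace a ℓ n) (ℬ : Hyperspace b ℓ' d) →
    Parbeddable ℬ 𝒜 →
    HasAcceptableColoring 𝒜 →
    HasAcceptableColoring ℬ
lemma3p6 {n = n} 𝒜 ℬ (β , f , f-inj , f-resp) (χ , χ-acceptable) =
  χ′ , χ′-acceptable
  where
  χ′ : Coloring ℬ
  χ′ = β ∘ χ ∘ f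

  χ′-acceptable : Acceptable ℬ χ′
  χ′-acceptable x₀ j =
    FiniteSubset-preimage f f-inj into (FiniteSubset-⋃ (χ-acceptable (f x₀)))
    where
    into : ∀ x → E ℬ j x₀ x × χ′ x ≡ j →
           Σ (Fin n) λ i → E 𝒜 i (f x₀) (f x) × χ (f x) ≡ i
    into x (x₀~x , χ′x≡j) =
      χ (f x) , f-resp x₀ x (χ (f x)) (subst (λ t → E ℬ t x₀ x) (sym χ′x≡j) x₀~x) , refl
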